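{- Let $(a_n)_{n\ge 1}$ be an integer sequence and let $d_n=a_{n+1}-a_n$. There exist a constant $c$, an integer $k\ge 0$ and rational numbers $q_1,\dots,q_k,r_1,\dots,r_k$ such that $a_n=c+\sum_{i=1}^k\lceil q_i n+r_i\rceil$ for all $n\ge1$ if and only if the sequence $(d_n)_{n\ge1}$ is periodic, i.e. there is an integer $p\ge1$ with $d_{n+p}=d_n$ for all $n\ge 1$. -}

module Defs where

open import Data.Nat using (ℕ)
open import Data.Integer using (ℤ; +_; _-_) renaming (_+_ to _+ℤ_)
open import Data.Rational using (ℚ; _/_; ceiling; _+_; _*_)
open import Data.List using (List; map; foldr)
open import Data.Product using (_×_; proj₁; proj₂)

ℕtoℚ : ℕ → ℚ
ℕtoℚ n = (+ n) / 1

diff : (ℕ → ℤ) → ℕ → ℤ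
diff a n = a (Data.Nat.suc n) - a n

ceilSum : List (ℚ × ℚ) → ℕ → ℤ
ceilSum qrs n = foldr _+ℤ_ (+ 0) (map (λ qr → ceiling (proj₁ qr * ℕtoℚ n + proj₂ qr)) qrs)

-- A term ⌈q n + r⌉ with q = s/t in lowest terms grows by exactly s when n grows by t, so a finite
-- sum of such terms satisfies f (n + p) = f n + k with p the product of the denominators, and its
-- difference sequence has period p.
--
-- Conversely, let the differences d n have period P. The jump ⌊(m+1)/P⌋ - ⌊m/P⌋ is 1 if P ∣ m + 1
-- and 0 otherwise, so between n and n + 1 exactly one of the floors ⌊(n+j)/P⌋, j < P, jumps: the
-- one with n + j + 1 ≡ 0 (mod P), and d n depends only on that j. Taking M ≥ every d n and weight
-- w j = M - d n for that j, the sequence M n - Σ_j w j ⌊(n+j)/P⌋ has differences d n; it is a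
-- ceiling sum, since M n = ⌈M n⌉ and -⌊(n+j)/P⌋ = ⌈-(n+j)/P⌉, the latter taken w j times.

module Submission where

open import Defs
open import Data.Nat using (ℕ; _≥_; _+_)
open import Data.Integer using (ℤ) renaming (_+_ to _+ℤ_)
open import Data.Rational using (ℚ)
open import Data.List using (List)
open import Data.Product using (_×_; ∃; ∃-syntax)
open import Function.Bundles using (_⇔_; mk⇔)
open import Relation.Binary.PropositionalEquality using (_≡_)

open import Data.Nat as ℕ using (zero; suc; _<_; _≤_; _∸_; s≤s; z≤n; NonZero)
import Data.Nat.Properties as ℕ
open import Data.Nat.DivMod using (_/_; _%_; m≡m%n+[m/n]*n; m%n<n; m<n⇒m/n≡0; m*n/n≡m; +-distrib-/-∣ʳ; n/n≡1; %-remove-+ʳ)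
open import Data.Nat.Divisibility using (_∣_; divides-refl; _∣?_; ∣-refl; ∣m∣n⇒∣m+n; m%n≡0⇒n∣m)
open import Data.Integer as ℤ using (+_; -[1+_]; +[1+_]; -_; _-_; _*_)
import Data.Integer.Properties as ℤ
open import Data.Integer.DivMod using ([n/ℕd]*d≤n; n<s[n/ℕd]*d; div-pos-is-/ℕ)
import Data.Integer.Tactic.RingSolver as ℤ-Solver
import Data.Nat.Tactic.RingSolver as ℕ-Solver
import Data.Rational as ℚ
import Data.Rational.Properties as ℚ
open import Data.Rational.Unnormalised as ℚᵘ using (ℚᵘ; mkℚᵘ; *≤*; *<*; *≡*; _≃_)
import Data.Rational.Unnormalised.Properties as ℚᵘ
open import Data.List using ([]; _∷_; _++_; replicate)
open import Data.Product using (_,_; proj₁; proj₂)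
open import Relation.Binary.PropositionalEquality using (refl; sym; trans; cong; cong₂; subst; subst₂; module ≡-Reasoning)
open import Relation.Nullary using (¬_; yes; no)
open import Data.Empty using (⊥-elim)
open import Data.Sum using (inj₁; inj₂)
open import Algebra.Bundles using (CommutativeRing)
open import Algebra.Solver.Ring.NaturalCoefficients.Default (CommutativeRing.commutativeSemiring ℚᵘ.+-*-commutativeRing) using (solve; _:*_; _:+_; _:=_)

fromℤ : ℤ → ℚᵘ
fromℤ z = mkℚᵘ z 0

fromℤ-+ : ∀ i j → fromℤ (i +ℤ j) ≃ fromℤ i ℚᵘ.+ fromℤ j
fromℤ-+ i j = *≡* (cong (_* + 1) (sym (cong₂ _+ℤ_ (ℤ.*-identityʳ i) (ℤ.*-identityʳ j))))

fromℤ-cancel-< : ∀ {i j} → fromℤ i ℚᵘ.< fromℤ j → i ℤ.< j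
fromℤ-cancel-< {i} {j} (*<* i<j) = subst₂ ℤ._<_ (ℤ.*-identityʳ i) (ℤ.*-identityʳ j) i<j

floor-lowerBound : ∀ p → fromℤ (ℚᵘ.floor p) ℚᵘ.≤ p
floor-lowerBound (mkℚᵘ n d) = *≤* (subst₂ ℤ._≤_
  (cong (_* + suc d) (sym (div-pos-is-/ℕ n (suc d)))) (sym (ℤ.*-identityʳ n)) ([n/ℕd]*d≤n n (suc d)))

floor-upperBound : ∀ p → p ℚᵘ.< fromℤ (ℤ.suc (ℚᵘ.floor p))
floor-upperBound (mkℚᵘ n d) = *<* (subst₂ ℤ._<_
  (sym (ℤ.*-identityʳ n)) (cong (λ w → ℤ.suc w * + suc d) (sym (div-pos-is-/ℕ n (suc d)))) (n<s[n/ℕd]*d n (suc d)))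

floor-unique : ∀ p z → fromℤ z ℚᵘ.≤ p → p ℚᵘ.< fromℤ (ℤ.suc z) → ℚᵘ.floor p ≡ z
floor-unique p z z≤p p<z+1 = ℤ.≤-antisym (below (floor-lowerBound p) p<z+1) (below z≤p (floor-upperBound p))
  where
  below : ∀ {x y} → fromℤ x ℚᵘ.≤ p → p ℚᵘ.< fromℤ (ℤ.suc y) → x ℤ.≤ y
  below {x} {y} x≤p p<y+1 =
    subst (x ℤ.≤_) (ℤ.pred-suc y) (ℤ.i<j⇒i≤pred[j] (fromℤ-cancel-< (ℚᵘ.≤-<-trans x≤p p<y+1)))

floor-cong : ∀ {p q} → p ≃ q → ℚᵘ.floor p ≡ ℚᵘ.floor q
floor-cong {p} {q} p≃q = sym (floor-unique q (ℚᵘ.floor p)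
  (ℚᵘ.≤-respʳ-≃ p≃q (floor-lowerBound p)) (ℚᵘ.<-respˡ-≃ p≃q (floor-upperBound p)))

floor-fromℤ : ∀ k → ℚᵘ.floor (fromℤ k) ≡ k
floor-fromℤ k = floor-unique (fromℤ k) k ℚᵘ.≤-refl (*<* (subst₂ ℤ._<_
  (sym (ℤ.*-identityʳ k)) (sym (ℤ.*-identityʳ (ℤ.suc k))) (ℤ.suc[i]≤j⇒i<j ℤ.≤-refl)))

floor-+-fromℤ : ∀ p k → ℚᵘ.floor (p ℚᵘ.+ fromℤ k) ≡ ℚᵘ.floor p +ℤ k
floor-+-fromℤ p k = floor-unique (p ℚᵘ.+ fromℤ k) (ℚᵘ.floor p +ℤ k)
  (ℚᵘ.≤-respˡ-≃ (ℚᵘ.≃-sym (fromℤ-+ (ℚᵘ.floor p) k)) (ℚᵘ.+-monoˡ-≤ (fromℤ k) (floor-lowerBound p)))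
  (ℚᵘ.<-respʳ-≃ (ℚᵘ.≃-sym (ℚᵘ.≃-trans (ℚᵘ.≃-reflexive (cong fromℤ (sym (ℤ.+-assoc (+ 1) (ℚᵘ.floor p) k))))
    (fromℤ-+ (ℤ.suc (ℚᵘ.floor p)) k))) (ℚᵘ.+-monoˡ-< (fromℤ k) (floor-upperBound p)))

ceiling-cong : ∀ {p q} → p ≃ q → ℚᵘ.ceiling p ≡ ℚᵘ.ceiling q
ceiling-cong {mkℚᵘ _ _} {mkℚᵘ _ _} p≃q = cong -_ (floor-cong (ℚᵘ.-‿cong p≃q))

ceiling-fromℤ : ∀ k → ℚᵘ.ceiling (fromℤ k) ≡ k
ceiling-fromℤ k = trans (cong -_ (floor-fromℤ (- k))) (ℤ.neg-involutive k)

ceiling-+-fromℤ : ∀ p k → ℚᵘ.ceiling (p ℚᵘ.+ fromℤ k) ≡ ℚᵘ.ceiling p +ℤ k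
ceiling-+-fromℤ p@(mkℚᵘ _ _) k = begin
  - ℚᵘ.floor (ℚᵘ.- (p ℚᵘ.+ fromℤ k))     ≡⟨ cong (λ v → - ℚᵘ.floor v) (ℚᵘ.neg-distrib-+ p (fromℤ k)) ⟩
  - ℚᵘ.floor (ℚᵘ.- p ℚᵘ.+ fromℤ (- k))    ≡⟨ cong -_ (floor-+-fromℤ (ℚᵘ.- p) (- k)) ⟩
  - (ℚᵘ.floor (ℚᵘ.- p) +ℤ - k)            ≡⟨ ℤ.neg-distrib-+ (ℚᵘ.floor (ℚᵘ.- p)) (- k) ⟩
  ℚᵘ.ceiling p +ℤ - - k                   ≡⟨ cong (ℚᵘ.ceiling p +ℤ_) (ℤ.neg-involutive k) ⟩
  ℚᵘ.ceiling p +ℤ k                       ∎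
  where open ≡-Reasoning

ceiling-toℚᵘ : ∀ p → ℚ.ceiling p ≡ ℚᵘ.ceiling (ℚ.toℚᵘ p)
ceiling-toℚᵘ (ℚ.mkℚ (+ zero) _ _) = refl
ceiling-toℚᵘ (ℚ.mkℚ +[1+ _ ] _ _) = refl
ceiling-toℚᵘ (ℚ.mkℚ -[1+ _ ] _ _) = refl

toℚᵘ-ℕtoℚ : ∀ n → ℚ.toℚᵘ (ℕtoℚ n) ≃ fromℤ (+ n)
toℚᵘ-ℕtoℚ n = ℚ.toℚᵘ-fromℚᵘ (fromℤ (+ n))

ceilTerm : ℚ × ℚ → ℕ → ℤ
ceilTerm qr n = ℚ.ceiling (proj₁ qr ℚ.* ℕtoℚ n ℚ.+ proj₂ qr)

ceilTerm-toℚᵘ : ∀ q r n → ceilTerm (q , r) n ≡ ℚᵘ.ceiling (ℚ.toℚᵘ q ℚᵘ.* fromℤ (+ n) ℚᵘ.+ ℚ.toℚᵘ r)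
ceilTerm-toℚᵘ q r n = trans (ceiling-toℚᵘ (q ℚ.* ℕtoℚ n ℚ.+ r)) (ceiling-cong
  (ℚᵘ.≃-trans (ℚ.toℚᵘ-homo-+ (q ℚ.* ℕtoℚ n) r) (ℚᵘ.+-congˡ (ℚ.toℚᵘ r)
    (ℚᵘ.≃-trans (ℚ.toℚᵘ-homo-* q (ℕtoℚ n)) (ℚᵘ.*-congˡ {ℚ.toℚᵘ q} (toℚᵘ-ℕtoℚ n))))))

ceilSum-++ : ∀ xs ys n → ceilSum (xs ++ ys) n ≡ ceilSum xs n +ℤ ceilSum ys n
ceilSum-++ []       ys n = sym (ℤ.+-identityˡ (ceilSum ys n))
ceilSum-++ (x ∷ xs) ys n = trans (cong (ceilTerm x n +ℤ_) (ceilSum-++ xs ys n))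
                                 (sym (ℤ.+-assoc (ceilTerm x n) (ceilSum xs n) (ceilSum ys n)))

ceilSum-replicate : ∀ k x n → ceilSum (replicate k x) n ≡ + k * ceilTerm x n
ceilSum-replicate zero    x n = sym (ℤ.*-zeroˡ (ceilTerm x n))
ceilSum-replicate (suc k) x n = begin
  ceilTerm x n +ℤ ceilSum (replicate k x) n   ≡⟨ cong (ceilTerm x n +ℤ_) (ceilSum-replicate k x n) ⟩
  ceilTerm x n +ℤ + k * ceilTerm x n          ≡⟨ regroup (ceilTerm x n) (+ k) ⟩
  (+ 1 +ℤ + k) * ceilTerm x n                 ∎
  where
  open ≡-Reasoning
  regroup : ∀ y k → y +ℤ k * y ≡ (+ 1 +ℤ k) * y
  regroup = ℤ-Solver.solve-∀

*-fromℤ-≃ : ∀ s d n → mkℚᵘ s d ℚᵘ.* fromℤ (+ n) ≃ mkℚᵘ (s * + n) d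
*-fromℤ-≃ s d n = *≡* (cong (λ x → (s * + n) * + suc x) (sym (ℕ.*-identityʳ d)))

+-sameDenominator : ∀ s u d → mkℚᵘ s d ℚᵘ.+ mkℚᵘ u d ≃ mkℚᵘ (s +ℤ u) d
+-sameDenominator s u d = *≡* (trans (factor s u (+ suc d)) (cong ((s +ℤ u) *_) (sym (ℤ.pos-* (suc d) (suc d)))))
  where
  factor : ∀ s u D → (s * D +ℤ u * D) * D ≡ (s +ℤ u) * (D * D)
  factor = ℤ-Solver.solve-∀

ceilTerm-fraction : ∀ s u d n → ceilTerm (s ℚ./ suc d , u ℚ./ suc d) n ≡ ℚᵘ.ceiling (mkℚᵘ (s * + n +ℤ u) d)
ceilTerm-fraction s u d n = trans (ceilTerm-toℚᵘ (s ℚ./ suc d) (u ℚ./ suc d) n) (ceiling-cong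
  (ℚᵘ.≃-trans (ℚᵘ.+-cong (ℚᵘ.*-congʳ {fromℤ (+ n)} (ℚ.toℚᵘ-fromℚᵘ (mkℚᵘ s d))) (ℚ.toℚᵘ-fromℚᵘ (mkℚᵘ u d)))
    (ℚᵘ.≃-trans (ℚᵘ.+-congˡ (mkℚᵘ u d) (*-fromℤ-≃ s d n)) (+-sameDenominator (s * + n) u d))))

+const⇒diff≡ : ∀ {a f} c → (∀ n → n ≥ 1 → a n ≡ c +ℤ f n) → ∀ n → n ≥ 1 → diff a n ≡ diff f n
+const⇒diff≡ {a} {f} c a≡c+f n n≥1 = begin
  a (suc n) - a n                     ≡⟨ cong₂ _-_ (a≡c+f (suc n) (s≤s z≤n)) (a≡c+f n n≥1) ⟩
  (c +ℤ f (suc n)) - (c +ℤ f n)       ≡⟨ cancel c (f (suc n)) (f n) ⟩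
  f (suc n) - f n                     ∎
  where
  open ≡-Reasoning
  cancel : ∀ c x y → (c +ℤ x) - (c +ℤ y) ≡ x - y
  cancel = ℤ-Solver.solve-∀

diff≡⇒+const : ∀ a f → (∀ n → n ≥ 1 → diff f n ≡ diff a n) → ∀ n → n ≥ 1 → a n ≡ (a 1 - f 1) +ℤ f n
diff≡⇒+const a f same-diff (suc zero)    _ = shift (a 1) (f 1)
  where
  shift : ∀ x y → x ≡ (x - y) +ℤ y
  shift = ℤ-Solver.solve-∀
diff≡⇒+const a f same-diff (suc (suc n)) _ = begin
  a (2 + n)                                 ≡⟨ step (a (2 + n)) (a (1 + n)) ⟩
  a (1 + n) +ℤ diff a (1 + n)               ≡⟨ cong₂ _+ℤ_ (diff≡⇒+const a f same-diff (suc n) (s≤s z≤n)) (sym (same-diff (suc n) (s≤s z≤n))) ⟩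
  (c +ℤ f (1 + n)) +ℤ diff f (1 + n)        ≡⟨ ℤ.+-assoc c (f (1 + n)) (diff f (1 + n)) ⟩
  c +ℤ (f (1 + n) +ℤ diff f (1 + n))        ≡⟨ cong (c +ℤ_) (step (f (2 + n)) (f (1 + n))) ⟨
  c +ℤ f (2 + n)                            ∎
  where
  open ≡-Reasoning
  c = a 1 - f 1
  step : ∀ y x → y ≡ x +ℤ (y - x)
  step = ℤ-Solver.solve-∀

m+[n+o]≡m+o+n : ∀ m n o → m + (n + o) ≡ m + o + n
m+[n+o]≡m+o+n = ℕ-Solver.solve-∀

QuasiPeriodic : (ℕ → ℤ) → ℕ → ℤ → Set
QuasiPeriodic f p k = ∀ n → f (n + p) ≡ f n +ℤ k

toℚᵘ*↧≃↥ : ∀ q → ℚ.toℚᵘ q ℚᵘ.* fromℤ (+ ℚ.↧ₙ q) ≃ fromℤ (ℚ.↥ q)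
toℚᵘ*↧≃↥ (ℚ.mkℚ s t _) = *≡* (trans (ℤ.*-identityʳ _) (cong (λ v → s * + v) (sym (ℕ.*-identityʳ (suc t)))))

ceilTerm-quasiPeriodic : ∀ q r → QuasiPeriodic (ceilTerm (q , r)) (ℚ.↧ₙ q) (ℚ.↥ q)
ceilTerm-quasiPeriodic q r n = begin
  ceilTerm (q , r) (n + t)                      ≡⟨ ceilTerm-toℚᵘ q r (n + t) ⟩
  ℚᵘ.ceiling (Q ℚᵘ.* fromℤ (+ (n + t)) ℚᵘ.+ R)   ≡⟨ ceiling-cong shift ⟩
  ℚᵘ.ceiling ((Q ℚᵘ.* N ℚᵘ.+ R) ℚᵘ.+ fromℤ (ℚ.↥ q)) ≡⟨ ceiling-+-fromℤ (Q ℚᵘ.* N ℚᵘ.+ R) (ℚ.↥ q) ⟩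
  ℚᵘ.ceiling (Q ℚᵘ.* N ℚᵘ.+ R) +ℤ ℚ.↥ q        ≡⟨ cong (_+ℤ ℚ.↥ q) (sym (ceilTerm-toℚᵘ q r n)) ⟩
  ceilTerm (q , r) n +ℤ ℚ.↥ q                  ∎
  where
  open ≡-Reasoning
  t = ℚ.↧ₙ q
  Q = ℚ.toℚᵘ q
  R = ℚ.toℚᵘ r
  N = fromℤ (+ n)
  T = fromℤ (+ t)
  distrib : Q ℚᵘ.* (N ℚᵘ.+ T) ℚᵘ.+ R ≃ (Q ℚᵘ.* N ℚᵘ.+ R) ℚᵘ.+ Q ℚᵘ.* T
  distrib = solve 4 (λ Q N T R → Q :* (N :+ T) :+ R := (Q :* N :+ R) :+ Q :* T) ℚᵘ.≃-refl Q N T R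
  shift : Q ℚᵘ.* fromℤ (+ (n + t)) ℚᵘ.+ R ≃ (Q ℚᵘ.* N ℚᵘ.+ R) ℚᵘ.+ fromℤ (ℚ.↥ q)
  shift = ℚᵘ.≃-trans (ℚᵘ.+-congˡ R (ℚᵘ.*-congˡ {Q} (ℚᵘ.≃-trans (ℚᵘ.≃-reflexive (cong fromℤ (ℤ.pos-+ n t))) (fromℤ-+ (+ n) (+ t)))))
    (ℚᵘ.≃-trans distrib (ℚᵘ.+-congʳ (Q ℚᵘ.* N ℚᵘ.+ R) (toℚᵘ*↧≃↥ q)))

quasiPeriodic-* : ∀ {f p k} → QuasiPeriodic f p k → ∀ m → QuasiPeriodic f (m ℕ.* p) (+ m * k)
quasiPeriodic-* {f} {k = k} _ zero n = begin
  f (n + 0)         ≡⟨ cong f (ℕ.+-identityʳ n) ⟩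
  f n               ≡⟨ ℤ.+-identityʳ (f n) ⟨
  f n +ℤ + 0 * k    ∎
  where open ≡-Reasoning
quasiPeriodic-* {f} {p} {k} fp≡fk (suc m) n = begin
  f (n + (p + m ℕ.* p))       ≡⟨ cong f (m+[n+o]≡m+o+n n p (m ℕ.* p)) ⟩
  f (n + m ℕ.* p + p)         ≡⟨ fp≡fk (n + m ℕ.* p) ⟩
  f (n + m ℕ.* p) +ℤ k        ≡⟨ cong (_+ℤ k) (quasiPeriodic-* {f} fp≡fk m n) ⟩
  (f n +ℤ + m * k) +ℤ k       ≡⟨ regroup (f n) (+ m) k ⟩
  f n +ℤ (+ 1 +ℤ + m) * k     ∎
  where
  open ≡-Reasoning
  regroup : ∀ x m k → (x +ℤ m * k) +ℤ k ≡ x +ℤ (+ 1 +ℤ m) * k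
  regroup = ℤ-Solver.solve-∀

quasiPeriodic-+ : ∀ {f g p k l} → QuasiPeriodic f p k → QuasiPeriodic g p l →
                  QuasiPeriodic (λ n → f n +ℤ g n) p (k +ℤ l)
quasiPeriodic-+ {f} {g} {p} {k} {l} fp≡fk gp≡gl n = begin
  f (n + p) +ℤ g (n + p)        ≡⟨ cong₂ _+ℤ_ (fp≡fk n) (gp≡gl n) ⟩
  (f n +ℤ k) +ℤ (g n +ℤ l)      ≡⟨ interchange (f n) k (g n) l ⟩
  (f n +ℤ g n) +ℤ (k +ℤ l)      ∎
  where
  open ≡-Reasoning
  interchange : ∀ x k y l → (x +ℤ k) +ℤ (y +ℤ l) ≡ (x +ℤ y) +ℤ (k +ℤ l)
  interchange = ℤ-Solver.solve-∀

ceilSum-quasiPeriodic : ∀ qrs → ∃[ p ] (p ≥ 1 × ∃[ k ] QuasiPeriodic (ceilSum qrs) p k)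
ceilSum-quasiPeriodic [] = 1 , s≤s z≤n , + 0 , λ _ → refl
ceilSum-quasiPeriodic ((q , r) ∷ qrs) with ceilSum-quasiPeriodic qrs
... | p , p≥1 , _ , qrs-qp =
  t ℕ.* p , ℕ.*-mono-≤ {1} {t} (s≤s z≤n) p≥1 , _ ,
  quasiPeriodic-+ {ceilTerm (q , r)} head (quasiPeriodic-* {ceilSum qrs} qrs-qp t)
  where
  t = ℚ.↧ₙ q
  head : QuasiPeriodic (ceilTerm (q , r)) (t ℕ.* p) (+ p * ℚ.↥ q)
  head = subst (λ m → QuasiPeriodic (ceilTerm (q , r)) m (+ p * ℚ.↥ q)) (ℕ.*-comm p t)
               (quasiPeriodic-* {ceilTerm (q , r)} (ceilTerm-quasiPeriodic q r) p)

diff-quasiPeriodic : ∀ {f p k} → QuasiPeriodic f p k → ∀ n → diff f (n + p) ≡ diff f n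
diff-quasiPeriodic {f} {p} {k} fp≡fk n = begin
  f (suc n + p) - f (n + p)       ≡⟨ cong₂ _-_ (fp≡fk (suc n)) (fp≡fk n) ⟩
  (f (suc n) +ℤ k) - (f n +ℤ k)   ≡⟨ cancel (f (suc n)) (f n) k ⟩
  f (suc n) - f n                 ∎
  where
  open ≡-Reasoning
  cancel : ∀ x y k → (x +ℤ k) - (y +ℤ k) ≡ x - y
  cancel = ℤ-Solver.solve-∀

ceilSum⇒periodicDiff : (a : ℕ → ℤ) → (∃[ c ] ∃[ qrs ] (∀ (n : ℕ) → n ≥ 1 → a n ≡ c +ℤ ceilSum qrs n)) →
                       ∃[ p ] (p ≥ 1 × (∀ (n : ℕ) → n ≥ 1 → diff a (n + p) ≡ diff a n))
ceilSum⇒periodicDiff a (c , qrs , a≡c+S) with ceilSum-quasiPeriodic qrs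
... | p , p≥1 , _ , S-qp = p , p≥1 , λ n n≥1 → begin
  diff a (n + p)             ≡⟨ +const⇒diff≡ {f = ceilSum qrs} c a≡c+S (n + p) (ℕ.≤-trans n≥1 (ℕ.m≤m+n n p)) ⟩
  diff (ceilSum qrs) (n + p) ≡⟨ diff-quasiPeriodic {ceilSum qrs} S-qp n ⟩
  diff (ceilSum qrs) n       ≡⟨ +const⇒diff≡ {f = ceilSum qrs} c a≡c+S n n≥1 ⟨
  diff a n                   ∎
  where open ≡-Reasoning

P∤1+m⇒[1+m]/P≡m/P : ∀ m P .{{_ : NonZero P}} → ¬ P ∣ suc m → suc m / P ≡ m / P
P∤1+m⇒[1+m]/P≡m/P m P P∤m+1 with suc m % P in eq
... | zero   = ⊥-elim (P∤m+1 (m%n≡0⇒n∣m (suc m) P eq))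
... | suc r  = sym (begin
  m / P                       ≡⟨ cong (_/ P) m≡r+wP ⟩
  (r + w ℕ.* P) / P           ≡⟨ +-distrib-/-∣ʳ r (divides-refl w) ⟩
  r / P + w ℕ.* P / P         ≡⟨ cong₂ _+_ (m<n⇒m/n≡0 r<P) (m*n/n≡m w P) ⟩
  w                           ∎)
  where
  open ≡-Reasoning
  w = suc m / P
  m≡r+wP : m ≡ r + w ℕ.* P
  m≡r+wP = ℕ.suc-injective (trans (m≡m%n+[m/n]*n (suc m) P) (cong (_+ w ℕ.* P) eq))
  r<P : r < P
  r<P = ℕ.<-trans (ℕ.n<1+n r) (subst (_< P) eq (m%n<n (suc m) P))

P∣m+k⇒P∣n+k⇒m%P≡n%P : ∀ {m n} k P .{{_ : NonZero P}} → P ∣ m + k → P ∣ n + k → m % P ≡ n % P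
P∣m+k⇒P∣n+k⇒m%P≡n%P {m} {n} k P P∣m+k P∣n+k = begin
  m % P               ≡⟨ %-remove-+ʳ m P∣n+k ⟨
  (m + (n + k)) % P   ≡⟨ cong (_% P) (swap m n k) ⟩
  (n + (m + k)) % P   ≡⟨ %-remove-+ʳ n P∣m+k ⟩
  n % P               ∎
  where
  open ≡-Reasoning
  swap : ∀ m n k → m + (n + k) ≡ n + (m + k)
  swap = ℕ-Solver.solve-∀

module FloorSum (P : ℕ) .{{_ : NonZero P}} where

  ⌊_/P⌋ : ℕ → ℤ
  ⌊ m /P⌋ = + (m / P)

  jump : ℕ → ℤ
  jump m = ⌊ suc m /P⌋ - ⌊ m /P⌋

  jump-∤ : ∀ m → ¬ P ∣ suc m → jump m ≡ + 0
  jump-∤ m P∤m+1 = trans (cong (λ v → + v - ⌊ m /P⌋) (P∤1+m⇒[1+m]/P≡m/P m P P∤m+1)) (ℤ.+-inverseʳ ⌊ m /P⌋)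

  ⌊n+P/P⌋-⌊n/P⌋≡1 : ∀ n → ⌊ n + P /P⌋ - ⌊ n /P⌋ ≡ + 1
  ⌊n+P/P⌋-⌊n/P⌋≡1 n = begin
    + ((n + P) / P) - + (n / P)       ≡⟨ cong (λ v → + v - + (n / P)) (+-distrib-/-∣ʳ n ∣-refl) ⟩
    + (n / P + P / P) - + (n / P)     ≡⟨ cong (λ v → + (n / P + v) - + (n / P)) (n/n≡1 P) ⟩
    + (n / P + 1) - + (n / P)         ≡⟨ cong (_- + (n / P)) (ℤ.pos-+ (n / P) 1) ⟩
    (+ (n / P) +ℤ + 1) - + (n / P)    ≡⟨ cancel (+ (n / P)) (+ 1) ⟩
    + 1                               ∎
    where
    open ≡-Reasoning
    cancel : ∀ x y → (x +ℤ y) - x ≡ y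
    cancel = ℤ-Solver.solve-∀

  floorSum : (ℕ → ℤ) → ℕ → ℕ → ℤ
  floorSum w zero    n = + 0
  floorSum w (suc J) n = w J * ⌊ n + J /P⌋ +ℤ floorSum w J n

  floorSum-suc : ∀ w x J n → (∀ j → j < J → w j * jump (n + j) ≡ x * jump (n + j)) →
                 floorSum w J (suc n) ≡ floorSum w J n +ℤ x * (⌊ n + J /P⌋ - ⌊ n /P⌋)
  floorSum-suc w x zero n _ = begin
    + 0                                       ≡⟨ vanish x ⌊ n /P⌋ ⟩
    + 0 +ℤ x * (⌊ n /P⌋ - ⌊ n /P⌋)            ≡⟨ cong (λ v → + 0 +ℤ x * (⌊ v /P⌋ - ⌊ n /P⌋)) (ℕ.+-identityʳ n) ⟨
    + 0 +ℤ x * (⌊ n + 0 /P⌋ - ⌊ n /P⌋)        ∎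
    where
    open ≡-Reasoning
    vanish : ∀ x y → + 0 ≡ + 0 +ℤ x * (y - y)
    vanish = ℤ-Solver.solve-∀
  floorSum-suc w x (suc J) n same-jumps = begin
    w J * B +ℤ floorSum w J (suc n)                ≡⟨ cong (w J * B +ℤ_) (floorSum-suc w x J n (λ j j<J → same-jumps j (ℕ.m<n⇒m<1+n j<J))) ⟩
    w J * B +ℤ (F +ℤ x * (A - N))                  ≡⟨ telescope (w J) x A B N F (same-jumps J ℕ.≤-refl) ⟩
    (w J * A +ℤ F) +ℤ x * (B - N)                  ≡⟨ cong (λ v → (w J * A +ℤ F) +ℤ x * (⌊ v /P⌋ - N)) (ℕ.+-suc n J) ⟨
    (w J * A +ℤ F) +ℤ x * (⌊ n + suc J /P⌋ - N)    ∎
    where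
    open ≡-Reasoning
    A = ⌊ n + J /P⌋
    B = ⌊ suc (n + J) /P⌋
    N = ⌊ n /P⌋
    F = floorSum w J n
    rearrange : ∀ W x A B N F → W * B +ℤ (F +ℤ x * (A - N)) ≡ ((W * A +ℤ F) +ℤ x * (B - N)) +ℤ (W * (B - A) - x * (B - A))
    rearrange = ℤ-Solver.solve-∀
    telescope : ∀ W x A B N F → W * (B - A) ≡ x * (B - A) → W * B +ℤ (F +ℤ x * (A - N)) ≡ (W * A +ℤ F) +ℤ x * (B - N)
    telescope W x A B N F W≈x = begin
      W * B +ℤ (F +ℤ x * (A - N))                                   ≡⟨ rearrange W x A B N F ⟩
      ((W * A +ℤ F) +ℤ x * (B - N)) +ℤ (W * (B - A) - x * (B - A))  ≡⟨ cong (λ v → ((W * A +ℤ F) +ℤ x * (B - N)) +ℤ (v - x * (B - A))) W≈x ⟩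
      ((W * A +ℤ F) +ℤ x * (B - N)) +ℤ (x * (B - A) - x * (B - A))  ≡⟨ cong (((W * A +ℤ F) +ℤ x * (B - N)) +ℤ_) (ℤ.+-inverseʳ (x * (B - A))) ⟩
      ((W * A +ℤ F) +ℤ x * (B - N)) +ℤ + 0                          ≡⟨ ℤ.+-identityʳ _ ⟩
      (W * A +ℤ F) +ℤ x * (B - N)                                   ∎

module Periodic (d : ℕ → ℤ) (P : ℕ) .{{_ : NonZero P}} (periodic : ∀ n → n ≥ 1 → d (n + P) ≡ d n) where

  periodic-+* : ∀ {m} k → m ≥ 1 → d (m + k ℕ.* P) ≡ d m
  periodic-+* {m} zero    m≥1 = cong d (ℕ.+-identityʳ m)
  periodic-+* {m} (suc k) m≥1 = begin
    d (m + (P + k ℕ.* P))   ≡⟨ cong d (m+[n+o]≡m+o+n m P (k ℕ.* P)) ⟩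
    d (m + k ℕ.* P + P)     ≡⟨ periodic (m + k ℕ.* P) (ℕ.≤-trans m≥1 (ℕ.m≤m+n m (k ℕ.* P))) ⟩
    d (m + k ℕ.* P)         ≡⟨ periodic-+* k m≥1 ⟩
    d m                     ∎
    where open ≡-Reasoning

  -- P + n % P rather than n % P, because periodicity is only assumed from index 1 on.
  periodic-% : ∀ {n} → n ≥ 1 → d n ≡ d (P + n % P)
  periodic-% {n} n≥1 = begin
    d n                                 ≡⟨ periodic n n≥1 ⟨
    d (n + P)                           ≡⟨ cong (λ v → d (v + P)) (m≡m%n+[m/n]*n n P) ⟩
    d (n % P + (n / P) ℕ.* P + P)       ≡⟨ cong d (swap (n % P) ((n / P) ℕ.* P) P) ⟩
    d (P + n % P + (n / P) ℕ.* P)       ≡⟨ periodic-+* (n / P) (ℕ.≤-trans (ℕ.>-nonZero⁻¹ P) (ℕ.m≤m+n P (n % P))) ⟩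
    d (P + n % P)                       ∎
    where
    open ≡-Reasoning
    swap : ∀ r q p → r + q + p ≡ p + r + q
    swap = ℕ-Solver.solve-∀

  periodic-∣ : ∀ {m n} k → m ≥ 1 → n ≥ 1 → P ∣ m + k → P ∣ n + k → d m ≡ d n
  periodic-∣ {m} {n} k m≥1 n≥1 P∣m+k P∣n+k = begin
    d m               ≡⟨ periodic-% m≥1 ⟩
    d (P + m % P)     ≡⟨ cong (λ v → d (P + v)) (P∣m+k⇒P∣n+k⇒m%P≡n%P k P P∣m+k P∣n+k) ⟩
    d (P + n % P)     ≡⟨ periodic-% n≥1 ⟨
    d n               ∎
    where open ≡-Reasoning

sumBelow : (ℕ → ℕ) → ℕ → ℕ
sumBelow f zero    = 0
sumBelow f (suc J) = f J + sumBelow f J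

≤-sumBelow : ∀ f {j J} → j < J → f j ≤ sumBelow f J
≤-sumBelow f {j} {suc J} (s≤s j≤J) with ℕ.m≤n⇒m<n∨m≡n j≤J
... | inj₁ j<J  = ℕ.≤-trans (≤-sumBelow f j<J) (ℕ.m≤n+m (sumBelow f J) (f J))
... | inj₂ refl = ℕ.m≤m+n (f J) (sumBelow f J)

i≤+∣i∣ : ∀ i → i ℤ.≤ + ℤ.∣ i ∣
i≤+∣i∣ (+ _)     = ℤ.≤-refl
i≤+∣i∣ -[1+ _ ]  = ℤ.-≤+

module Construction (a : ℕ → ℤ) (p : ℕ) (periodic : ∀ n → n ≥ 1 → diff a (n + suc p) ≡ diff a n) where

  P : ℕ
  P = suc p

  open FloorSum P
  open Periodic (diff a) P periodic

  -- D j is the common value of diff a n over the n ≥ 1 with n + j + 1 ≡ 0 (mod P).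
  D : ℕ → ℤ
  D j = diff a (P + (P ∸ suc j))

  diff≡D : ∀ {j n} → j < P → n ≥ 1 → P ∣ suc (n + j) → diff a n ≡ D j
  diff≡D {j} {n} j<P n≥1 P∣n+j+1 = periodic-∣ (suc j) n≥1 (s≤s z≤n)
    (subst (P ∣_) (sym (ℕ.+-suc n j)) P∣n+j+1)
    (subst (P ∣_) (sym (representative+j+1≡P+P)) (∣m∣n⇒∣m+n ∣-refl ∣-refl))
    where
    representative+j+1≡P+P : P + (P ∸ suc j) + suc j ≡ P + P
    representative+j+1≡P+P = trans (ℕ.+-assoc P (P ∸ suc j) (suc j)) (cong (λ x → P + x) (ℕ.m∸n+n≡m j<P))

  M : ℕ
  M = sumBelow (λ j → ℤ.∣ D j ∣) P

  multiplicity : ℕ → ℕ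
  multiplicity j = ℤ.∣ + M - D j ∣

  multiplicity≡M-D : ∀ {j} → j < P → + multiplicity j ≡ + M - D j
  multiplicity≡M-D {j} j<P = ℤ.0≤i⇒+∣i∣≡i (ℤ.i≤j⇒0≤j-i
    (ℤ.≤-trans (i≤+∣i∣ (D j)) (ℤ.+≤+ (≤-sumBelow (λ i → ℤ.∣ D i ∣) j<P))))

  multiplicity-jump : ∀ {j n} → j < P → n ≥ 1 →
                      + multiplicity j * jump (n + j) ≡ (+ M - diff a n) * jump (n + j)
  multiplicity-jump {j} {n} j<P n≥1 with P ∣? suc (n + j)
  ... | yes P∣n+j+1 = cong (_* jump (n + j))
          (trans (multiplicity≡M-D j<P) (cong (λ x → + M - x) (sym (diff≡D j<P n≥1 P∣n+j+1))))
  ... | no  P∤n+j+1 = begin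
    + multiplicity j * jump (n + j)   ≡⟨ cong (+ multiplicity j *_) (jump-∤ (n + j) P∤n+j+1) ⟩
    + multiplicity j * + 0            ≡⟨ ℤ.*-zeroʳ (+ multiplicity j) ⟩
    + 0                               ≡⟨ ℤ.*-zeroʳ (+ M - diff a n) ⟨
    (+ M - diff a n) * + 0            ≡⟨ cong ((+ M - diff a n) *_) (jump-∤ (n + j) P∤n+j+1) ⟨
    (+ M - diff a n) * jump (n + j)   ∎
    where open ≡-Reasoning

  negFloorTerm : ℕ → ℚ × ℚ
  negFloorTerm j = -[1+ 0 ] ℚ./ P , - + j ℚ./ P

  ceilTerm-negFloorTerm : ∀ j n → ceilTerm (negFloorTerm j) n ≡ - ⌊ n + j /P⌋
  ceilTerm-negFloorTerm j n = begin
    ceilTerm (negFloorTerm j) n                        ≡⟨ ceilTerm-fraction -[1+ 0 ] (- + j) p n ⟩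
    - ℚᵘ.floor (mkℚᵘ (- (-[1+ 0 ] * + n +ℤ - + j)) p)   ≡⟨ cong (λ v → - ℚᵘ.floor (mkℚᵘ v p)) (negate (+ n) (+ j)) ⟩
    - ℚᵘ.floor (mkℚᵘ (+ n +ℤ + j) p)                    ≡⟨ cong (λ v → - ℚᵘ.floor (mkℚᵘ v p)) (ℤ.pos-+ n j) ⟨
    - ℚᵘ.floor (mkℚᵘ (+ (n + j)) p)                     ≡⟨ cong -_ (div-pos-is-/ℕ (+ (n + j)) P) ⟩
    - ⌊ n + j /P⌋                                       ∎
    where
    open ≡-Reasoning
    negate : ∀ x y → - (-[1+ 0 ] * x +ℤ - y) ≡ x +ℤ y
    negate = ℤ-Solver.solve-∀

  negFloorTerms : ℕ → List (ℚ × ℚ)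
  negFloorTerms zero    = []
  negFloorTerms (suc J) = replicate (multiplicity J) (negFloorTerm J) ++ negFloorTerms J

  ceilSum-negFloorTerms : ∀ J n → ceilSum (negFloorTerms J) n ≡ - floorSum (λ j → + multiplicity j) J n
  ceilSum-negFloorTerms zero    n = refl
  ceilSum-negFloorTerms (suc J) n = begin
    ceilSum (replicate k (negFloorTerm J) ++ negFloorTerms J) n   ≡⟨ ceilSum-++ (replicate k (negFloorTerm J)) (negFloorTerms J) n ⟩
    ceilSum (replicate k (negFloorTerm J)) n +ℤ ceilSum (negFloorTerms J) n
      ≡⟨ cong₂ _+ℤ_ (trans (ceilSum-replicate k (negFloorTerm J) n) (cong (+ k *_) (ceilTerm-negFloorTerm J n)))
                    (ceilSum-negFloorTerms J n) ⟩
    + k * - ⌊ n + J /P⌋ +ℤ - floorSum (λ j → + multiplicity j) J n  ≡⟨ negate (+ k) ⌊ n + J /P⌋ _ ⟩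
    - (+ k * ⌊ n + J /P⌋ +ℤ floorSum (λ j → + multiplicity j) J n)  ∎
    where
    open ≡-Reasoning
    k = multiplicity J
    negate : ∀ k x y → k * - x +ℤ - y ≡ - (k * x +ℤ y)
    negate = ℤ-Solver.solve-∀

  linearTerm : ℚ × ℚ
  linearTerm = ℕtoℚ M , ℕtoℚ 0

  ceilTerm-linearTerm : ∀ n → ceilTerm linearTerm n ≡ + M * + n
  ceilTerm-linearTerm n = trans (ceilTerm-fraction (+ M) (+ 0) 0 n)
    (trans (cong (λ v → ℚᵘ.ceiling (fromℤ v)) (ℤ.+-identityʳ (+ M * + n))) (ceiling-fromℤ (+ M * + n)))

  qrs : List (ℚ × ℚ)
  qrs = linearTerm ∷ negFloorTerms P

  diff-ceilSum : ∀ n → n ≥ 1 → diff (ceilSum qrs) n ≡ diff a n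
  diff-ceilSum n n≥1 = begin
    ceilSum qrs (suc n) - ceilSum qrs n
      ≡⟨ cong₂ _-_ (cong₂ _+ℤ_ (ceilTerm-linearTerm (suc n)) (ceilSum-negFloorTerms P (suc n)))
                   (cong₂ _+ℤ_ (ceilTerm-linearTerm n) (ceilSum-negFloorTerms P n)) ⟩
    (+ M * + suc n +ℤ - F (suc n)) - (+ M * + n +ℤ - F n)
      ≡⟨ cong (λ v → (+ M * + suc n +ℤ - v) - (+ M * + n +ℤ - F n))
              (floorSum-suc (λ j → + multiplicity j) (+ M - diff a n) P n (λ j j<P → multiplicity-jump j<P n≥1)) ⟩
    (+ M * + suc n +ℤ - (F n +ℤ (+ M - diff a n) * (⌊ n + P /P⌋ - ⌊ n /P⌋))) - (+ M * + n +ℤ - F n)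
      ≡⟨ cong (λ v → (+ M * + suc n +ℤ - (F n +ℤ (+ M - diff a n) * v)) - (+ M * + n +ℤ - F n)) (⌊n+P/P⌋-⌊n/P⌋≡1 n) ⟩
    (+ M * (+ 1 +ℤ + n) +ℤ - (F n +ℤ (+ M - diff a n) * + 1)) - (+ M * + n +ℤ - F n)
      ≡⟨ collapse (+ M) (+ n) (F n) (diff a n) ⟩
    diff a n ∎
    where
    open ≡-Reasoning
    F = floorSum (λ j → + multiplicity j) P
    collapse : ∀ M n F d → (M * (+ 1 +ℤ n) +ℤ - (F +ℤ (M - d) * + 1)) - (M * n +ℤ - F) ≡ d
    collapse = ℤ-Solver.solve-∀

periodicDiff⇒ceilSum : (a : ℕ → ℤ) → ∃[ p ] (p ≥ 1 × (∀ (n : ℕ) → n ≥ 1 → diff a (n + p) ≡ diff a n)) →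
                       ∃[ c ] ∃[ qrs ] (∀ (n : ℕ) → n ≥ 1 → a n ≡ c +ℤ ceilSum qrs n)
periodicDiff⇒ceilSum a (zero  , ()  , _)
periodicDiff⇒ceilSum a (suc p , _   , periodic) =
  a 1 - ceilSum qrs 1 , qrs , diff≡⇒+const a (ceilSum qrs) diff-ceilSum
  where open Construction a p periodic

mainTheorem2 : (a : ℕ → ℤ) →
    (∃[ c ] ∃[ qrs ] (∀ (n : ℕ) → n ≥ 1 → a n ≡ c +ℤ ceilSum qrs n))
    ⇔ (∃[ p ] (p ≥ 1 × (∀ (n : ℕ) → n ≥ 1 → diff a (n + p) ≡ diff a n)))
mainTheorem2 a = mk⇔ (ceilSum⇒periodicDiff a) (periodicDiff⇒ceilSum a)
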